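{- Let $G=(V,E)$ be a finite connected $k$-regular simple graph on $n$ vertices. Then $$h(G) < k\,\lambda(G)\sqrt{\frac{n}{\lfloor n/2\rfloor}}.$$
   Context: For a finite connected simple graph $G=(V,E)$ on $n$ vertices, the expansion (isoperimetric) constant is $h(G)=\min\{|\partial F|/|F| : F\subset V,\ 0<|F|\le n/2\}$, where $\partial F$ is the set of edges joining a vertex of $F$ to a vertex of $V\setminus F$. An $L(2,1)$-colouring of $G$ is a map $f:V\to\mathbb{Z}_{\ge 0}$ such that $|f(u)-f(v)|\ge 2$ whenever $u,v$ are adjacent and $|f(u)-f(v)|\ge 1$ whenever $u,v$ are at distance two. The span of $f$ is $\max f-\min f$, and $\lambda(G)$ (the $\lambda$-chromatic number, or $L(2,1)$-chromatic number) is the minimum span over all $L(2,1)$-colourings of $G$. -}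

module Defs where

open import Data.Bool using (Bool; true; false; T; not; _∧_)
open import Data.Nat as ℕ using (ℕ; zero; suc; _+_; _*_; _∸_; _≤_; _<_; _⊔_; _⊓_)
open import Data.Nat.Base using (>-nonZero)
open import Data.Fin using (Fin)
open import Data.Fin.Subset using (Subset; _∈_; ∣_∣)
open import Data.Vec using (lookup)
open import Data.List using (List; []; _∷_; length; filterᵇ; allFin; foldr; map; concatMap)
open import Data.Integer using (+_)
open import Data.Rational using (ℚ; _/_)
open import Data.Product using (Σ; ∃; ∃-syntax; _×_; _,_)
open import Relation.Binary.PropositionalEquality using (_≡_; _≢_)
open import Relation.Nullary using (¬_)
open import Data.Sum using (_⊎_)

record Graph (n : ℕ) : Set where
  field
    adj    : Fin n → Fin n → Bool
    sym    : ∀ u v → adj u v ≡ adj v u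
    irrefl : ∀ v → adj v v ≡ false
open Graph public

Adj : ∀ {n} → Graph n → Fin n → Fin n → Set
Adj G u v = T (adj G u v)

data Reachable {n} (G : Graph n) : Fin n → Fin n → Set where
  here : ∀ {v} → Reachable G v v
  step : ∀ {u w v} → Adj G u w → Reachable G w v → Reachable G u v

Connected : ∀ {n} → Graph n → Set
Connected G = ∀ u v → Reachable G u v

degree : ∀ {n} → Graph n → Fin n → ℕ
degree {n} G v = length (filterᵇ (adj G v) (allFin n))

Regular : ∀ {n} → Graph n → ℕ → Set
Regular G k = ∀ v → degree G v ≡ k

-- number of edges with one end in F and the other outside F
-- (each such edge is counted once, as the ordered pair (u ∈ F, v ∉ F))
boundarySize : ∀ {n} → Graph n → Subset n → ℕ
boundarySize {n} G F =
  length (concatMap (λ u → filterᵇ (λ v → lookup F u ∧ not (lookup F v) ∧ adj G u v) (allFin n)) (allFin n))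

-- admissible sets in the definition of h: 0 < |F| ≤ n/2, i.e. 2|F| ≤ n
Admissible : ∀ {n} → Subset n → Set
Admissible {n} F = (0 < ∣ F ∣) × (2 * ∣ F ∣ ≤ n)

ratio : ∀ {n} (G : Graph n) (F : Subset n) → 0 < ∣ F ∣ → ℚ
ratio G F p = (+ boundarySize G F) / ∣ F ∣
  where instance _ = >-nonZero p

IsExpansionConstant : ∀ {n} → Graph n → ℚ → Set
IsExpansionConstant {n} G h =
  (∃[ F ] Σ (Admissible F) (λ a → h ≡ ratio G F (Data.Product.proj₁ a)))
  × (∀ (F : Subset n) (a : Admissible F) → h Data.Rational.≤ ratio G F (Data.Product.proj₁ a))

Dist2 : ∀ {n} → Graph n → Fin n → Fin n → Set
Dist2 G u v = u ≢ v × ¬ Adj G u v × ∃[ w ] (Adj G u w × Adj G w v)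

IsL21 : ∀ {n} → Graph n → (Fin n → ℕ) → Set
IsL21 G f =
  (∀ u v → Adj G u v → 2 + f u ≤ f v ⊎ 2 + f v ≤ f u)
  × (∀ u v → Dist2 G u v → f u ≢ f v)

maxVal minVal span : ∀ {n} → (Fin n → ℕ) → ℕ
maxVal {n} f = foldr _⊔_ 0 (map f (allFin n))
minVal {n} f = foldr _⊓_ (maxVal f) (map f (allFin n))
span f = maxVal f ∸ minVal f

IsLambdaNumber : ∀ {n} → Graph n → ℕ → Set
IsLambdaNumber {n} G l =
  (∃[ f ] (IsL21 G f × span f ≡ l))
  × (∀ (f : Fin n → ℕ) → IsL21 G f → l ≤ span f)

module Submission where

-- The existence of an admissible set forces n ≥ 2, so a single vertex is admissible; its
-- boundary has at most k edges, whence 0 ≤ h ≤ k.  Connectivity provides an edge, so k ≥ 1,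
-- and the ends of an edge receive colours at least 2 apart, so λ ≥ 2.  Therefore
-- h² ⌊n/2⌋ ≤ k² ⌊n/2⌋ < k² λ² n, which is the squared form of the claim.

open import Defs
open import Data.Nat using (ℕ; _*_; _/_)
open import Data.Integer using (+_)
open import Data.Rational using (ℚ; _<_) renaming (_*_ to _*q_; _/_ to _/q_)

open import Data.Bool using (Bool; false; T; not; _∧_)
open import Data.Bool.Properties using (T-∧; T?)
open import Data.Empty using (⊥-elim)
open import Data.Fin using (Fin; zero; suc)
open import Data.Fin.Subset using (⁅_⁆; ∣_∣)
open import Data.Fin.Subset.Properties using (∣⁅x⁆∣≡1)
open import Data.Integer using (+≤+; +<+)
import Data.Integer as ℤ
import Data.Integer.Properties as ℤ
open import Data.List using (List; []; _∷_; _++_; length; filterᵇ; allFin; tabulate; concatMap; foldr)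
open import Data.List.Properties using (++-identityʳ)
import Data.List.Properties as List
open import Data.List.Membership.Propositional using (_∈_; lose)
open import Data.List.Membership.Propositional.Properties using (∈-allFin; ∈-map⁺)
open import Data.List.Relation.Unary.Any using (here; there)
import Data.List.Relation.Unary.All as All
open import Data.List.Relation.Binary.Sublist.Propositional using (⊆-refl)
import Data.List.Relation.Binary.Sublist.Propositional.Properties as Sublist
open import Data.Nat as ℕ using (suc; _≤_; _⊔_; _⊓_; z≤n; s≤s; >-nonZero)
import Data.Nat.DivMod as ℕ
import Data.Nat.Properties as ℕ
open import Data.Nat.Coprimality using (1-coprimeTo) renaming (sym to coprime-sym)
open import Data.Product using (∃; _,_; proj₂)
import Data.Rational as ℚ
import Data.Rational.Properties as ℚ
import Data.Rational.Unnormalised as ℚᵘ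
import Data.Rational.Unnormalised.Properties as ℚᵘ
open import Data.Sum using (inj₁; inj₂)
open import Data.Vec using (lookup)
open import Data.Vec.Properties using (lookup-replicate)
open import Function.Base using (_∘_)
open import Function.Bundles using (Equivalence)
open import Relation.Binary.PropositionalEquality using (_≡_; _≢_; refl; cong; cong₂; subst)
import Relation.Binary.PropositionalEquality as ≡
open import Relation.Nullary using (contradiction)

length-filterᵇ-mono : ∀ {A : Set} {p q : A → Bool} → (∀ x → T (p x) → T (q x)) →
                      ∀ xs → length (filterᵇ p xs) ≤ length (filterᵇ q xs)
length-filterᵇ-mono {p = p} {q} p⇒q xs =
  Sublist.length-mono-≤ (Sublist.filter⁺ (T? ∘ p) (T? ∘ q) (λ { refl → p⇒q _ }) (⊆-refl {x = xs}))

concatMap-tabulate-[] : ∀ {A B : Set} (g : A → List B) {m} (f : Fin m → A) →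
                        (∀ i → g (f i) ≡ []) → concatMap g (tabulate f) ≡ []
concatMap-tabulate-[] g {ℕ.zero} f g∘f≡[] = refl
concatMap-tabulate-[] g {suc m} f g∘f≡[] rewrite g∘f≡[] zero =
  concatMap-tabulate-[] g (f ∘ suc) (g∘f≡[] ∘ suc)

≤-foldr-⊔ : ∀ {x} z {xs} → x ∈ xs → x ≤ foldr _⊔_ z xs
≤-foldr-⊔ z {y ∷ ys} (here refl)  = ℕ.m≤m⊔n y _
≤-foldr-⊔ z {y ∷ ys} (there x∈ys) = ℕ.≤-trans (≤-foldr-⊔ z x∈ys) (ℕ.m≤n⊔m y _)

foldr-⊓-≤ : ∀ {x} z {xs} → x ∈ xs → foldr _⊓_ z xs ≤ x
foldr-⊓-≤ z {y ∷ ys} (here refl)  = ℕ.m⊓n≤m y _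
foldr-⊓-≤ z {y ∷ ys} (there x∈ys) = ℕ.≤-trans (ℕ.m⊓n≤n y _) (foldr-⊓-≤ z x∈ys)

fromℕ : ℕ → ℚ
fromℕ a = (+ a) /q 1

fromℕ≡mkℚ : ∀ a → fromℕ a ≡ ℚ.mkℚ (+ a) 0 (coprime-sym (1-coprimeTo a))
fromℕ≡mkℚ a = ℚ.normalize-coprime (coprime-sym (1-coprimeTo a))

toℚᵘ-fromℕ : ∀ a → ℚ.toℚᵘ (fromℕ a) ≡ ℚᵘ.mkℚᵘ (+ a) 0
toℚᵘ-fromℕ a = cong ℚ.toℚᵘ (fromℕ≡mkℚ a)

fromℕ-nonNeg : ∀ a → ℚ.NonNegative (fromℕ a)
fromℕ-nonNeg a = ℚ.normalize-nonNeg a 1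

fromℕ-mono-≤ : ∀ {a b} → a ≤ b → fromℕ a ℚ.≤ fromℕ b
fromℕ-mono-≤ {a} {b} a≤b rewrite fromℕ≡mkℚ a | fromℕ≡mkℚ b =
  ℚ.*≤* (ℤ.*-monoʳ-≤-nonNeg (+ 1) (+≤+ a≤b))

fromℕ-mono-< : ∀ {a b} → a ℕ.< b → fromℕ a < fromℕ b
fromℕ-mono-< {a} {b} a<b rewrite fromℕ≡mkℚ a | fromℕ≡mkℚ b =
  ℚ.*<* (ℤ.*-monoʳ-<-pos (+ 1) (+<+ a<b))

fromℕ-homo-* : ∀ a b → fromℕ (a * b) ≡ fromℕ a *q fromℕ b
fromℕ-homo-* a b = ℚ.toℚᵘ-injective (begin
    ℚ.toℚᵘ (fromℕ (a * b))                   ≡⟨ toℚᵘ-fromℕ (a * b) ⟩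
    ℚᵘ.mkℚᵘ (+ (a * b)) 0                     ≈⟨ ℚᵘ.*≡* (cong (ℤ._* + 1) (ℤ.pos-* a b)) ⟩
    ℚᵘ.mkℚᵘ (+ a) 0 ℚᵘ.* ℚᵘ.mkℚᵘ (+ b) 0      ≡⟨ cong₂ ℚᵘ._*_ (toℚᵘ-fromℕ a) (toℚᵘ-fromℕ b) ⟨
    ℚ.toℚᵘ (fromℕ a) ℚᵘ.* ℚ.toℚᵘ (fromℕ b)   ≈⟨ ℚ.toℚᵘ-homo-* (fromℕ a) (fromℕ b) ⟨
    ℚ.toℚᵘ (fromℕ a *q fromℕ b)              ∎)
  where open import Relation.Binary.Reasoning.Setoid ℚᵘ.≃-setoid

0≤p≤q⇒p*p≤q*q : ∀ {p q} → ℚ.0ℚ ℚ.≤ p → p ℚ.≤ q → p *q p ℚ.≤ q *q q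
0≤p≤q⇒p*p≤q*q {p} {q} 0≤p p≤q = begin
    p *q p  ≤⟨ ℚ.*-monoˡ-≤-nonNeg p {{ℚ.nonNegative 0≤p}} p≤q ⟩
    p *q q  ≤⟨ ℚ.*-monoʳ-≤-nonNeg q {{ℚ.nonNegative (ℚ.≤-trans 0≤p p≤q)}} p≤q ⟩
    q *q q  ∎
  where open ℚ.≤-Reasoning

p*p*m<N : ∀ {p k m N} → ℚ.0ℚ ℚ.≤ p → p ℚ.≤ fromℕ k → k * k * m ℕ.< N →
          (p *q p) *q fromℕ m < fromℕ N
p*p*m<N {p} {k} {m} {N} 0≤p p≤k k*k*m<N = begin-strict
    (p *q p) *q fromℕ m               ≤⟨ ℚ.*-monoʳ-≤-nonNeg (fromℕ m) {{fromℕ-nonNeg m}}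
                                           (0≤p≤q⇒p*p≤q*q 0≤p p≤k) ⟩
    (fromℕ k *q fromℕ k) *q fromℕ m   ≡⟨ cong (_*q fromℕ m) (fromℕ-homo-* k k) ⟨
    fromℕ (k * k) *q fromℕ m          ≡⟨ fromℕ-homo-* (k * k) m ⟨
    fromℕ (k * k * m)                 <⟨ fromℕ-mono-< k*k*m<N ⟩
    fromℕ N                           ∎
  where open ℚ.≤-Reasoning

k*k*n/2<kl*kl*n : ∀ {k l n} → 0 ℕ.< k → 0 ℕ.< l → 0 ℕ.< n →
                  k * k * (n / 2) ℕ.< (k * l) * (k * l) * n
k*k*n/2<kl*kl*n {k} {l} {n} 0<k 0<l 0<n = begin-strict
    k * k * (n / 2)        <⟨ ℕ.*-monoʳ-< (k * k) {{k*k≢0}} n/2<n ⟩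
    k * k * n              ≤⟨ ℕ.*-monoˡ-≤ n (ℕ.*-mono-≤ k≤k*l k≤k*l) ⟩
    (k * l) * (k * l) * n  ∎
  where
  open ℕ.≤-Reasoning
  k*k≢0 = ℕ.m*n≢0 k k {{>-nonZero 0<k}} {{>-nonZero 0<k}}
  n/2<n : n / 2 ℕ.< n
  n/2<n = ℕ.m/n<m n 2 {{>-nonZero 0<n}} (s≤s (s≤s z≤n))
  k≤k*l : k ≤ k * l
  k≤k*l = ℕ.m≤m*n k l {{>-nonZero 0<l}}

reachable⇒neighbour : ∀ {n} {G : Graph n} {u v} → Reachable G u v → u ≢ v → ∃ (Adj G u)
reachable⇒neighbour here        u≢u = ⊥-elim (u≢u refl)
reachable⇒neighbour (step uw _) _   = _ , uw

neighbour⇒0<degree : ∀ {n} (G : Graph n) {v w} → Adj G v w → 0 ℕ.< degree G v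
neighbour⇒0<degree G {v} {w} vw = List.filter-some (T? ∘ adj G v) (lose (∈-allFin w) vw)

boundarySize-⁅zero⁆≤degree : ∀ {n} (G : Graph (suc n)) → boundarySize G ⁅ zero ⁆ ≤ degree G zero
boundarySize-⁅zero⁆≤degree {n} G = begin
    boundarySize G S               ≡⟨ cong (λ r → length (edgesFrom zero ++ r))
                                           (concatMap-tabulate-[] edgesFrom suc noEdgesFromSuc) ⟩
    length (edgesFrom zero ++ [])  ≡⟨ cong length (++-identityʳ (edgesFrom zero)) ⟩
    length (edgesFrom zero)        ≤⟨ length-filterᵇ-mono {p = λ v → not (lookup S v) ∧ adj G zero v}
                                        {q = adj G zero} (λ _ → proj₂ ∘ Equivalence.to T-∧) (allFin (suc n)) ⟩
    degree G zero                  ∎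
  where
  open ℕ.≤-Reasoning
  S = ⁅ zero ⁆
  edgesFrom : Fin (suc n) → List (Fin (suc n))
  edgesFrom u = filterᵇ (λ v → lookup S u ∧ not (lookup S v) ∧ adj G u v) (allFin (suc n))
  noEdgesFromSuc : ∀ i → edgesFrom (suc i) ≡ []
  noEdgesFromSuc i rewrite lookup-replicate i false =
    List.filter-none (T? ∘ (λ _ → false)) (All.universal (λ _ ()) (allFin (suc n)))

ratio-nonNeg : ∀ {n} (G : Graph n) F (0<∣F∣ : 0 ℕ.< ∣ F ∣) → ℚ.0ℚ ℚ.≤ ratio G F 0<∣F∣
ratio-nonNeg G F 0<∣F∣ =
  ℚ.nonNegative⁻¹ _ {{ℚ.normalize-nonNeg (boundarySize G F) ∣ F ∣ {{>-nonZero 0<∣F∣}}}}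

∣F∣≡1⇒ratio≡boundarySize : ∀ {n} (G : Graph n) F (0<∣F∣ : 0 ℕ.< ∣ F ∣) → ∣ F ∣ ≡ 1 →
                           ratio G F 0<∣F∣ ≡ fromℕ (boundarySize G F)
∣F∣≡1⇒ratio≡boundarySize G F 0<∣F∣ ∣F∣≡1 = over1 ∣ F ∣ 0<∣F∣ ∣F∣≡1
  where
  over1 : ∀ d (0<d : 0 ℕ.< d) → d ≡ 1 →
          ((+ boundarySize G F) /q d) {{>-nonZero 0<d}} ≡ fromℕ (boundarySize G F)
  over1 _ _ refl = refl

expansionConstant⇒2≤n : ∀ {n} (G : Graph n) {h} → IsExpansionConstant G h → 2 ≤ n
expansionConstant⇒2≤n G ((F , (0<∣F∣ , 2∣F∣≤n) , _) , _) = ℕ.≤-trans (ℕ.*-monoʳ-≤ 2 0<∣F∣) 2∣F∣≤n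

expansionConstant-nonNeg : ∀ {n} (G : Graph n) {h} → IsExpansionConstant G h → ℚ.0ℚ ℚ.≤ h
expansionConstant-nonNeg G ((F , (0<∣F∣ , _) , h≡ratio) , _) =
  subst (ℚ.0ℚ ℚ.≤_) (≡.sym h≡ratio) (ratio-nonNeg G F 0<∣F∣)

expansionConstant≤degree : ∀ {n} (G : Graph (suc (suc n))) {h} → IsExpansionConstant G h →
                           h ℚ.≤ fromℕ (degree G zero)
expansionConstant≤degree {n} G {h} (_ , minimal) = begin
    h                         ≤⟨ minimal S (0<∣S∣ , 2∣S∣≤n) ⟩
    ratio G S 0<∣S∣           ≡⟨ ∣F∣≡1⇒ratio≡boundarySize G S 0<∣S∣ ∣S∣≡1 ⟩
    fromℕ (boundarySize G S)  ≤⟨ fromℕ-mono-≤ (boundarySize-⁅zero⁆≤degree G) ⟩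
    fromℕ (degree G zero)     ∎
  where
  open ℚ.≤-Reasoning
  S = ⁅ zero ⁆
  ∣S∣≡1 : ∣ S ∣ ≡ 1
  ∣S∣≡1 = ∣⁅x⁆∣≡1 {suc (suc n)} zero
  0<∣S∣ : 0 ℕ.< ∣ S ∣
  0<∣S∣ = ℕ.≤-reflexive (≡.sym ∣S∣≡1)
  2∣S∣≤n : 2 * ∣ S ∣ ≤ suc (suc n)
  2∣S∣≤n = subst (λ s → 2 * s ≤ suc (suc n)) (≡.sym ∣S∣≡1) (s≤s (s≤s z≤n))

≤-span : ∀ {n} (f : Fin n → ℕ) {d} a b → d ℕ.+ f a ≤ f b → d ≤ span f
≤-span f {d} a b d+fa≤fb = ℕ.m+n≤o⇒m≤o∸n d (begin
    d ℕ.+ minVal f  ≤⟨ ℕ.+-monoʳ-≤ d (foldr-⊓-≤ (maxVal f) (∈-map⁺ f (∈-allFin a))) ⟩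
    d ℕ.+ f a       ≤⟨ d+fa≤fb ⟩
    f b             ≤⟨ ≤-foldr-⊔ 0 (∈-map⁺ f (∈-allFin b)) ⟩
    maxVal f        ∎)
  where open ℕ.≤-Reasoning

L21⇒2≤span : ∀ {n} (G : Graph n) {f u v} → IsL21 G f → Adj G u v → 2 ≤ span f
L21⇒2≤span G {f} {u} {v} (separated , _) uv with separated u v uv
... | inj₁ 2+fu≤fv = ≤-span f u v 2+fu≤fv
... | inj₂ 2+fv≤fu = ≤-span f v u 2+fv≤fu

lambdaNumber≥2 : ∀ {n} (G : Graph n) {l u v} → IsLambdaNumber G l → Adj G u v → 2 ≤ l
lambdaNumber≥2 G ((f , isL21 , span≡l) , _) uv = subst (2 ≤_) span≡l (L21⇒2≤span G isL21 uv)

mainTheorem1 : (n : ℕ) (G : Graph n) (k : ℕ) → Connected G → Regular G k →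
    (h : ℚ) (l : ℕ) → IsExpansionConstant G h → IsLambdaNumber G l →
    (h *q h) *q ((+ (n / 2)) /q 1) < (+ ((k * l) * (k * l) * n)) /q 1
mainTheorem1 0 G _ _ _ _ _ isExp _ = contradiction (expansionConstant⇒2≤n G isExp) λ ()
mainTheorem1 1 G _ _ _ _ _ isExp _ = contradiction (expansionConstant⇒2≤n G isExp) λ { (s≤s ()) }
mainTheorem1 n@(suc (suc _)) G k connected regular h l isExp isλ =
  p*p*m<N {k = k} {m = n / 2} (expansionConstant-nonNeg G isExp) h≤k
          (k*k*n/2<kl*kl*n 0<k 0<l (s≤s z≤n))
  where
  edge : ∃ (Adj G zero)
  edge = reachable⇒neighbour (connected zero (suc zero)) λ ()
  0<k : 0 ℕ.< k
  0<k = subst (0 ℕ.<_) (regular zero) (neighbour⇒0<degree G (proj₂ edge))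
  0<l : 0 ℕ.< l
  0<l = ℕ.≤-trans (s≤s z≤n) (lambdaNumber≥2 G isλ (proj₂ edge))
  h≤k : h ℚ.≤ fromℕ k
  h≤k = subst (λ d → h ℚ.≤ fromℕ d) (regular zero) (expansionConstant≤degree G isExp)
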